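{- The function $M:\mathbb{Z}_{\ge0}^3\to\mathbb{Z}$, $M(n,k,j)=\binom{n}{j}\binom{k+j}{n}$, has the triple Lucas property.
   Context: A function $M:\mathbb{Z}_{\ge0}^3\to\mathbb{Z}$ has the triple Lucas property if $M(n,k,j)=0$ whenever $j>n$, and for every prime $p$ and all $n,k,j\ge0$, writing $n=\sum_{i=0}^r n_ip^i$, $k=\sum_{i=0}^r k_ip^i$, $j=\sum_{i=0}^r j_ip^i$ with base-$p$ digits in $\{0,\dots,p-1\}$ (padded with zeros to a common length), $M(n,k,j)\equiv\prod_{i=0}^r M(n_i,k_i,j_i)\pmod p$. -}

module Defs where

open import Data.Nat as ℕ using (ℕ; zero; suc; _<_; _^_; _/_; _%_)
open import Data.Nat.Combinatorics using (_C_)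
open import Data.Nat.Properties using (m^n≢0)
open import Data.Nat.Primality using (Prime; prime⇒nonZero)
open import Data.Integer as ℤ using (ℤ; +_; _-_)
open import Data.Integer.Divisibility using (_∣_)
open import Data.Product using (_×_)
open import Relation.Binary.PropositionalEquality using (_≡_)

_≡_[mod_] : ℤ → ℤ → ℕ → Set
a ≡ b [mod m ] = (+ m) ∣ (a - b)

-- The i-th base-p digit of n (in {0,…,p-1}; beyond the length of the
-- expansion of n it is 0, which realises the zero padding).
digit : (p : ℕ) .{{_ : ℕ.NonZero p}} → ℕ → ℕ → ℕ
digit p n i = (_/_ n (p ^ i) {{m^n≢0 p i}}) % p

prodUpTo : ℕ → (ℕ → ℤ) → ℤ
prodUpTo zero    f = f 0
prodUpTo (suc r) f = prodUpTo r f ℤ.* f (suc r)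

-- Triple Lucas property of M : ℤ≥0³ → ℤ.
-- (1) M(n,k,j) = 0 whenever j > n;
-- (2) for each prime p, all n,k,j and every common length r+1 of the
--     padded base-p expansions (i.e. n,k,j < p^(r+1)),
--     M(n,k,j) ≡ ∏_{i=0}^r M(n_i,k_i,j_i) (mod p).
TripleLucas : (ℕ → ℕ → ℕ → ℤ) → Set
TripleLucas M =
  (∀ n k j → n < j → M n k j ≡ + 0)
  × ((p : ℕ) (pr : Prime p) (n k j r : ℕ) →
      n < p ^ suc r → k < p ^ suc r → j < p ^ suc r →
      M n k j ≡ prodUpTo r (λ i → M (digit p {{prime⇒nonZero pr}} n i)
                                    (digit p {{prime⇒nonZero pr}} k i)
                                    (digit p {{prime⇒nonZero pr}} j i)) [mod p ])

Mbin : ℕ → ℕ → ℕ → ℤ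
Mbin n k j = + ((n C j) ℕ.* ((k ℕ.+ j) C n))

-- Lucas's theorem, C(a,b) ≡ C(a₀,b₀)·C(a′,b′) (mod p) with a = a₀ + p·a′ and b = b₀ + p·b′
-- (a₀, b₀ < p), follows from Pascal's rule by induction; the one carry case that is not
-- an identity uses p ∣ C(p,i) for 0 < i < p.  If k₀ + j₀ < p there is no carry in k + j,
-- and Lucas applied to both factors of M(n,k,j) = C(n,j)·C(k+j,n) gives
-- M(n,k,j) ≡ M(n₀,k₀,j₀)·M(n′,k′,j′).  Otherwise the last digit of k + j is smaller
-- than j₀, hence either n₀ < j₀ or (k+j)₀ < n₀, and both sides vanish mod p by Lucas.
-- Iterating over the digits gives the product formula.

module Submission where

open import Defs
open import Data.Nat
open import Data.Nat.Properties
open import Data.Nat.DivMod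
open import Data.Nat.Combinatorics using (_C_; k>n⇒nCk≡0; nCn≡1; nC1≡n; nCk+nC[k+1]≡[n+1]C[k+1])
open import Data.Nat.Divisibility using (_∣_; divides; ∣⇒≤; n∣m⇒m%n≡0)
open import Data.Nat.Primality using (Prime; euclidsLemma; prime⇒nonZero)
open import Data.Nat.Tactic.RingSolver using (solve-∀)
open import Data.Integer as ℤ using (+_)
open import Data.Integer.Properties using (pos-+; pos-*)
import Data.Integer.Divisibility.Signed as Signed
import Data.Integer.Tactic.RingSolver as ℤSolver
open import Data.Product using (_×_; _,_)
open import Data.Sum using (_⊎_; inj₁; inj₂)
open import Relation.Nullary using (contradiction; yes; no)
open import Relation.Binary.PropositionalEquality
open ≡-Reasoning

%-cong-+ : ∀ d .{{_ : NonZero d}} {a b c e} → a % d ≡ b % d → c % d ≡ e % d → (a + c) % d ≡ (b + e) % d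
%-cong-+ d {a} {b} {c} {e} a≡b c≡e = begin
  (a + c) % d             ≡⟨ %-distribˡ-+ a c d ⟩
  (a % d + c % d) % d     ≡⟨ cong₂ (λ u v → (u + v) % d) a≡b c≡e ⟩
  (b % d + e % d) % d     ≡⟨ %-distribˡ-+ b e d ⟨
  (b + e) % d             ∎

%-cong-* : ∀ d .{{_ : NonZero d}} {a b c e} → a % d ≡ b % d → c % d ≡ e % d → (a * c) % d ≡ (b * e) % d
%-cong-* d {a} {b} {c} {e} a≡b c≡e = begin
  (a * c) % d             ≡⟨ %-distribˡ-* a c d ⟩
  (a % d * (c % d)) % d   ≡⟨ cong₂ (λ u v → (u * v) % d) a≡b c≡e ⟩
  (b % d * (e % d)) % d   ≡⟨ %-distribˡ-* b e d ⟨
  (b * e) % d             ∎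

0%n≡0 : ∀ n .{{_ : NonZero n}} → 0 % n ≡ 0
0%n≡0 n = m<n⇒m%n≡m (>-nonZero⁻¹ n)

m%d≡0⇒[m*n]%d≡0 : ∀ m n d .{{_ : NonZero d}} → m % d ≡ 0 → (m * n) % d ≡ 0
m%d≡0⇒[m*n]%d≡0 m n d m%d≡0 = trans (%-cong-* d (trans m%d≡0 (sym (0%n≡0 d))) refl) (0%n≡0 d)

m%d≡0⇒[n*m]%d≡0 : ∀ m n d .{{_ : NonZero d}} → m % d ≡ 0 → (n * m) % d ≡ 0
m%d≡0⇒[n*m]%d≡0 m n d m%d≡0 = subst (λ x → x % d ≡ 0) (*-comm m n) (m%d≡0⇒[m*n]%d≡0 m n d m%d≡0)

divMod-unique : ∀ {x r t} d .{{_ : NonZero d}} → r < d → x ≡ r + t * d → x % d ≡ r × x / d ≡ t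
divMod-unique {x} {r} {t} d r<d refl = x%d≡r , *-cancelʳ-≡ _ t d (+-cancelˡ-≡ r _ _ (begin
  r + x / d * d          ≡⟨ cong (_+ x / d * d) x%d≡r ⟨
  x % d + x / d * d      ≡⟨ m≡m%n+[m/n]*n x d ⟨
  r + t * d              ∎))
  where x%d≡r : x % d ≡ r
        x%d≡r = trans ([m+kn]%n≡m%n r t d) (m<n⇒m%n≡m r<d)

carry⇒[m+n]%d<n : ∀ {m n} d .{{_ : NonZero d}} → m < d → n < d → d ≤ m + n → (m + n) % d < n
carry⇒[m+n]%d<n {m} {n} d m<d n<d d≤m+n = subst (_< n) m+n∸d≡[m+n]%d m+n∸d<n
  where
  m+n∸d<n : m + n ∸ d < n
  m+n∸d<n = subst (m + n ∸ d <_) (m+n∸m≡n d n) (∸-monoˡ-< (+-monoˡ-< n m<d) d≤m+n)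
  m+n∸d≡[m+n]%d : m + n ∸ d ≡ (m + n) % d
  m+n∸d≡[m+n]%d = trans (sym (m<n⇒m%n≡m (<-trans m+n∸d<n n<d))) (m≤n⇒[n∸m]%m≡n%m d≤m+n)

suc-digits : ∀ x d .{{_ : NonZero d}} →
               (suc (x % d) < d × suc x % d ≡ suc (x % d) × suc x / d ≡ x / d)
             ⊎ (suc (x % d) ≡ d × suc x % d ≡ 0 × suc x / d ≡ suc (x / d))
suc-digits x d with m≤n⇒m<n∨m≡n (m%n<n x d)
... | inj₁ lt = inj₁ (lt , divMod-unique d lt suc-x≡)
  where suc-x≡ : suc x ≡ suc (x % d) + x / d * d
        suc-x≡ = cong suc (m≡m%n+[m/n]*n x d)
... | inj₂ eq = inj₂ (eq , divMod-unique d (>-nonZero⁻¹ d) suc-x≡)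
  where suc-x≡ : suc x ≡ 0 + suc (x / d) * d
        suc-x≡ = trans (cong suc (m≡m%n+[m/n]*n x d)) (cong (_+ x / d * d) eq)

digit-zero : ∀ d .{{_ : NonZero d}} n → digit d n 0 ≡ n % d
digit-zero d n = cong (_% d) (n/1≡n n)

digit-suc : ∀ d .{{_ : NonZero d}} n i → digit d n (suc i) ≡ digit d (n / d) i
digit-suc d n i = cong (_% d) (sym (m/n/o≡m/[n*o] n d (d ^ i)))
  where instance _ = m^n≢0 d i
                 _ = m^n≢0 d (suc i)

m<d^[1+r]⇒m/d<d^r : ∀ {m} d .{{_ : NonZero d}} r → m < d ^ suc r → m / d < d ^ r
m<d^[1+r]⇒m/d<d^r {m} d r m<d^[1+r] = m<n*o⇒m/o<n (subst (m <_) (*-comm d (d ^ r)) m<d^[1+r])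

C-absorption : ∀ n k → (suc n C suc k) * suc k ≡ suc n * (n C k)
C-absorption n zero = trans (*-identityʳ (suc n C 1)) (trans (nC1≡n (suc n)) (sym (*-identityʳ (suc n))))
C-absorption zero (suc k) = refl
C-absorption (suc n) (suc k) = begin
  (suc (suc n) C suc (suc k)) * (2 + k)          ≡⟨ cong (_* (2 + k)) (nCk+nC[k+1]≡[n+1]C[k+1] (suc n) (suc k)) ⟨
  (X + Z) * (2 + k)                              ≡⟨ expand X Z k ⟩
  X * suc k + X + Z * (2 + k)                    ≡⟨ cong₂ (λ u v → u + X + v) (C-absorption n k) (C-absorption n (suc k)) ⟩
  suc n * (n C k) + X + suc n * (n C suc k)      ≡⟨ collect (suc n) (n C k) X (n C suc k) ⟩
  suc n * (n C k + n C suc k) + X                ≡⟨ cong (λ u → suc n * u + X) (nCk+nC[k+1]≡[n+1]C[k+1] n k) ⟩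
  suc n * X + X                                  ≡⟨ +-comm (suc n * X) X ⟩
  suc (suc n) * X                                ∎
  where
  X Z : ℕ
  X = suc n C suc k
  Z = suc n C suc (suc k)
  expand : ∀ x z k → (x + z) * (2 + k) ≡ x * suc k + x + z * (2 + k)
  expand = solve-∀
  collect : ∀ m a x b → m * a + x + m * b ≡ m * (a + b) + x
  collect = solve-∀

prime∣pCk : ∀ {p k} → Prime p → 0 < k → k < p → p ∣ p C k
prime∣pCk {suc q} {suc k} pr _ k<p with euclidsLemma (suc q C suc k) (suc k) pr
                                   (divides (q C k) (trans (C-absorption q k) (*-comm (suc q) (q C k))))
... | inj₁ p∣C = p∣C
... | inj₂ p∣k = contradiction (∣⇒≤ p∣k) (<⇒≱ k<p)

pascal-*ʳ : ∀ n k x → (n C k) * x + (n C suc k) * x ≡ (suc n C suc k) * x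
pascal-*ʳ n k x = trans (sym (*-distribʳ-+ x (n C k) (n C suc k))) (cong (_* x) (nCk+nC[k+1]≡[n+1]C[k+1] n k))

module Lucas {p : ℕ} (pr : Prime p) where

  instance
    p≢0 : NonZero p
    p≢0 = prime⇒nonZero pr

  pascal-digits : ∀ a b →
    ((a % p C b % p) * (a / p C b / p) + (a % p C suc b % p) * (a / p C suc b / p)) % p
      ≡ ((suc a % p C suc b % p) * (suc a / p C suc b / p)) % p
  pascal-digits a b with suc-digits a p | suc-digits b p
  ... | inj₁ (_ , a%≡ , a/≡) | inj₁ (_ , b%≡ , b/≡) rewrite a%≡ | a/≡ | b%≡ | b/≡ =
    cong (_% p) (pascal-*ʳ (a % p) (b % p) (a / p C b / p))
  ... | inj₁ (a%<p , a%≡ , a/≡) | inj₂ (b%≡p , b%≡ , b/≡) rewrite a%≡ | a/≡ | b%≡ | b/≡ =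
    cong (λ x → (x * (a / p C b / p) + 1 * (a / p C suc (b / p))) % p)
         (k>n⇒nCk≡0 (≤-pred (≤-trans a%<p (≤-reflexive (sym b%≡p)))))
  ... | inj₂ (a%≡p , a%≡ , a/≡) | inj₁ (b%<p , b%≡ , b/≡) rewrite a%≡ | a/≡ | b%≡ | b/≡ =
    trans (cong (_% p) (pascal-*ʳ (a % p) (b % p) (a / p C b / p)))
          (trans (m%d≡0⇒[m*n]%d≡0 _ _ p p∣pC) (sym (0%n≡0 p)))
    where
    p∣pC : (suc (a % p) C suc (b % p)) % p ≡ 0
    p∣pC = subst (λ x → (x C suc (b % p)) % p ≡ 0) (sym a%≡p) (n∣m⇒m%n≡0 _ p (prime∣pCk pr z<s b%<p))
  ... | inj₂ (a%≡p , a%≡ , a/≡) | inj₂ (b%≡p , b%≡ , b/≡) rewrite a%≡ | a/≡ | b%≡ | b/≡ =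
    cong (_% p) (begin
      (a % p C b % p) * X + 1 * Y   ≡⟨ cong (λ x → (a % p C x) * X + 1 * Y) b%≡a% ⟩
      (a % p C a % p) * X + 1 * Y   ≡⟨ cong (λ c → c * X + 1 * Y) (nCn≡1 (a % p)) ⟩
      1 * X + 1 * Y                 ≡⟨ *-distribˡ-+ 1 X Y ⟨
      1 * (X + Y)                   ≡⟨ cong (1 *_) (nCk+nC[k+1]≡[n+1]C[k+1] (a / p) (b / p)) ⟩
      1 * (suc (a / p) C suc (b / p)) ∎)
    where
    X Y : ℕ
    X = a / p C b / p
    Y = a / p C suc (b / p)
    b%≡a% : b % p ≡ a % p
    b%≡a% = suc-injective (trans b%≡p (sym a%≡p))

  lucas : ∀ a b → (a C b) % p ≡ ((a % p C b % p) * (a / p C b / p)) % p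
  lucas a zero = cong₂ (λ x y → ((a % p C x) * (a / p C y)) % p) (sym (0%n≡0 p)) (sym (0/n≡0 p))
  lucas zero (suc b) with suc b % p | suc b / p | m≡m%n+[m/n]*n (suc b) p
  ... | suc u | v     | _  = cong (λ x → ((x C suc u) * (0 / p C v)) % p) (sym (0%n≡0 p))
  ... | zero  | suc v | _  = cong (λ y → ((0 % p C 0) * (y C suc v)) % p) (sym (0/n≡0 p))
  ... | zero  | zero  | ()
  lucas (suc a) (suc b) = begin
    (suc a C suc b) % p                                                                   ≡⟨ cong (_% p) (nCk+nC[k+1]≡[n+1]C[k+1] a b) ⟨
    (a C b + a C suc b) % p                                                               ≡⟨ %-cong-+ p (lucas a b) (lucas a (suc b)) ⟩
    ((a % p C b % p) * (a / p C b / p) + (a % p C suc b % p) * (a / p C suc b / p)) % p   ≡⟨ pascal-digits a b ⟩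
    ((suc a % p C suc b % p) * (suc a / p C suc b / p)) % p                               ∎

  lucas-vanishes : ∀ {a b} → a % p < b % p → (a C b) % p ≡ 0
  lucas-vanishes {a} {b} a%<b% = begin
    (a C b) % p                                  ≡⟨ lucas a b ⟩
    ((a % p C b % p) * (a / p C b / p)) % p      ≡⟨ cong (λ x → (x * (a / p C b / p)) % p) (k>n⇒nCk≡0 a%<b%) ⟩
    0 % p                                        ≡⟨ 0%n≡0 p ⟩
    0                                            ∎

prodUpToℕ : ℕ → (ℕ → ℕ) → ℕ
prodUpToℕ zero    f = f 0
prodUpToℕ (suc r) f = prodUpToℕ r f * f (suc r)

prodUpToℕ-suc : ∀ r f → prodUpToℕ (suc r) f ≡ f 0 * prodUpToℕ r (λ i → f (suc i))
prodUpToℕ-suc zero    f = refl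
prodUpToℕ-suc (suc r) f = trans (cong (_* f (2 + r)) (prodUpToℕ-suc r f)) (*-assoc (f 0) _ _)

prodUpToℕ-cong : ∀ r {f g} → (∀ i → f i ≡ g i) → prodUpToℕ r f ≡ prodUpToℕ r g
prodUpToℕ-cong zero    f≗g = f≗g 0
prodUpToℕ-cong (suc r) f≗g = cong₂ _*_ (prodUpToℕ-cong r f≗g) (f≗g (suc r))

prodUpTo-+ : ∀ r f → prodUpTo r (λ i → + f i) ≡ + prodUpToℕ r f
prodUpTo-+ zero    f = refl
prodUpTo-+ (suc r) f = trans (cong (ℤ._* + f (suc r)) (prodUpTo-+ r f)) (sym (pos-* (prodUpToℕ r f) (f (suc r))))

SplitsOffLastDigit : (d : ℕ) .{{_ : NonZero d}} → (ℕ → ℕ → ℕ → ℕ) → Set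
SplitsOffLastDigit d M =
  ∀ n k j → M n k j % d ≡ (M (n % d) (k % d) (j % d) * M (n / d) (k / d) (j / d)) % d

module _ {d : ℕ} .{{_ : NonZero d}} {M : ℕ → ℕ → ℕ → ℕ} where

  private
    M-cong : ∀ {n n′ k k′ j j′} → n ≡ n′ → k ≡ k′ → j ≡ j′ → M n k j ≡ M n′ k′ j′
    M-cong refl refl refl = refl

  digit-product : SplitsOffLastDigit d M → ∀ r n k j → n < d ^ suc r → k < d ^ suc r → j < d ^ suc r →
                  M n k j % d ≡ prodUpToℕ r (λ i → M (digit d n i) (digit d k i) (digit d j i)) % d
  digit-product split zero n k j n<d k<d j<d =
    cong (_% d) (M-cong (digit-of-small n n<d) (digit-of-small k k<d) (digit-of-small j j<d))
    where
    digit-of-small : ∀ x → x < d ^ 1 → x ≡ digit d x 0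
    digit-of-small x x<d = sym (trans (digit-zero d x) (m<n⇒m%n≡m (subst (x <_) (*-identityʳ d) x<d)))
  digit-product split (suc r) n k j n< k< j< = begin
    M n k j % d
      ≡⟨ split n k j ⟩
    (M (n % d) (k % d) (j % d) * M (n / d) (k / d) (j / d)) % d
      ≡⟨ %-cong-* d {M (n % d) (k % d) (j % d)} refl
           (digit-product split r (n / d) (k / d) (j / d) (quotient< n<) (quotient< k<) (quotient< j<)) ⟩
    (M (n % d) (k % d) (j % d) * prodUpToℕ r (λ i → M (digit d (n / d) i) (digit d (k / d) i) (digit d (j / d) i))) % d
      ≡⟨ cong₂ (λ x y → (x * y) % d)
               (M-cong (sym (digit-zero d n)) (sym (digit-zero d k)) (sym (digit-zero d j)))
               (prodUpToℕ-cong r (λ i → M-cong (sym (digit-suc d n i)) (sym (digit-suc d k i)) (sym (digit-suc d j i)))) ⟩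
    (M (digit d n 0) (digit d k 0) (digit d j 0) * prodUpToℕ r (λ i → M (digit d n (suc i)) (digit d k (suc i)) (digit d j (suc i)))) % d
      ≡⟨ cong (_% d) (prodUpToℕ-suc r (λ i → M (digit d n i) (digit d k i) (digit d j i))) ⟨
    prodUpToℕ (suc r) (λ i → M (digit d n i) (digit d k i) (digit d j i)) % d ∎
    where
    quotient< : ∀ {x} → x < d ^ suc (suc r) → x / d < d ^ suc r
    quotient< = m<d^[1+r]⇒m/d<d^r d (suc r)

%≡⇒≡[mod] : ∀ {m n} d .{{_ : NonZero d}} → m % d ≡ n % d → (+ m) ≡ + n [mod d ]
%≡⇒≡[mod] {m} {n} d m%≡n% = Signed.∣⇒∣ᵤ (Signed.divides (+ (m / d) ℤ.- + (n / d)) (begin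
  + m ℤ.- + n
    ≡⟨ cong₂ ℤ._-_ (+-divMod m) (trans (+-divMod n) (cong (λ r → + r ℤ.+ + (n / d) ℤ.* + d) (sym m%≡n%))) ⟩
  (+ (m % d) ℤ.+ + (m / d) ℤ.* + d) ℤ.- (+ (m % d) ℤ.+ + (n / d) ℤ.* + d)
    ≡⟨ cancel (+ (m % d)) (+ (m / d)) (+ (n / d)) (+ d) ⟩
  (+ (m / d) ℤ.- + (n / d)) ℤ.* + d ∎))
  where
  +-divMod : ∀ x → + x ≡ + (x % d) ℤ.+ + (x / d) ℤ.* + d
  +-divMod x = begin
    + x                                ≡⟨ cong +_ (m≡m%n+[m/n]*n x d) ⟩
    + (x % d + x / d * d)              ≡⟨ pos-+ (x % d) (x / d * d) ⟩
    + (x % d) ℤ.+ + (x / d * d)        ≡⟨ cong (λ y → + (x % d) ℤ.+ y) (pos-* (x / d) d) ⟩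
    + (x % d) ℤ.+ + (x / d) ℤ.* + d    ∎
  cancel : ∀ r a b e → (r ℤ.+ a ℤ.* e) ℤ.- (r ℤ.+ b ℤ.* e) ≡ (a ℤ.- b) ℤ.* e
  cancel = ℤSolver.solve-∀

splitsOffLastDigit⇒tripleLucas : (M : ℕ → ℕ → ℕ → ℕ) → (∀ n k j → n < j → M n k j ≡ 0) →
                                 (∀ p (pr : Prime p) → SplitsOffLastDigit p {{prime⇒nonZero pr}} M) →
                                 TripleLucas (λ n k j → + M n k j)
splitsOffLastDigit⇒tripleLucas M M-vanishes split =
  (λ n k j n<j → cong +_ (M-vanishes n k j n<j)) ,
  λ p pr n k j r n< k< j< → let instance _ = prime⇒nonZero pr in
    subst (λ z → (+ M n k j) ≡ z [mod p ]) (sym (prodUpTo-+ r _))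
          (%≡⇒≡[mod] p (digit-product (split p pr) r n k j n< k< j<))

Mbinℕ : ℕ → ℕ → ℕ → ℕ
Mbinℕ n k j = (n C j) * ((k + j) C n)

module _ {p : ℕ} (pr : Prime p) where

  open Lucas pr

  Mbinℕ-vanishes : ∀ n {k j} → (k + j) % p < j % p → Mbinℕ n k j % p ≡ 0
  Mbinℕ-vanishes n {k} {j} [k+j]%<j% with n % p <? j % p
  ... | yes n%<j% = m%d≡0⇒[m*n]%d≡0 (n C j) _ p (lucas-vanishes n%<j%)
  ... | no  n%≮j% = m%d≡0⇒[n*m]%d≡0 ((k + j) C n) (n C j) p
                      (lucas-vanishes (<-≤-trans [k+j]%<j% (≮⇒≥ n%≮j%)))

  Mbinℕ-split : SplitsOffLastDigit p Mbinℕ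
  Mbinℕ-split n k j with k % p + j % p <? p
  ... | yes no-carry = begin
    ((n C j) * ((k + j) C n)) % p
      ≡⟨ %-cong-* p (lucas n j) (lucas (k + j) n) ⟩
    (((n % p C j % p) * (n / p C j / p)) * (((k + j) % p C n % p) * ((k + j) / p C n / p))) % p
      ≡⟨ cong₂ (λ x y → (((n % p C j % p) * (n / p C j / p)) * ((x C n % p) * (y C n / p))) % p) [k+j]%p [k+j]/p ⟩
    (((n % p C j % p) * (n / p C j / p)) * (((k % p + j % p) C n % p) * ((k / p + j / p) C n / p))) % p
      ≡⟨ cong (_% p) (interchange (n % p C j % p) (n / p C j / p) ((k % p + j % p) C n % p) ((k / p + j / p) C n / p)) ⟩
    (Mbinℕ (n % p) (k % p) (j % p) * Mbinℕ (n / p) (k / p) (j / p)) % p ∎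
    where
    [k+j]%p : (k + j) % p ≡ k % p + j % p
    [k+j]%p = trans (%-distribˡ-+ k j p) (m<n⇒m%n≡m no-carry)
    [k+j]/p : (k + j) / p ≡ k / p + j / p
    [k+j]/p = +-distrib-/ k j no-carry
    interchange : ∀ a b c d → (a * b) * (c * d) ≡ (a * c) * (b * d)
    interchange = solve-∀
  ... | no carry = trans (Mbinℕ-vanishes n [k+j]%<j%)
                         (sym (m%d≡0⇒[m*n]%d≡0 _ _ p (Mbinℕ-vanishes (n % p) [k%+j%]%<j%%)))
    where
    [k%+j%]%<j% : (k % p + j % p) % p < j % p
    [k%+j%]%<j% = carry⇒[m+n]%d<n p (m%n<n k p) (m%n<n j p) (≮⇒≥ carry)
    [k+j]%<j% : (k + j) % p < j % p
    [k+j]%<j% = subst (_< j % p) (sym (%-distribˡ-+ k j p)) [k%+j%]%<j%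
    [k%+j%]%<j%% : (k % p + j % p) % p < j % p % p
    [k%+j%]%<j%% = subst ((k % p + j % p) % p <_) (sym (m%n%n≡m%n j p)) [k%+j%]%<j%

lemma3p4 : TripleLucas Mbin
lemma3p4 = splitsOffLastDigit⇒tripleLucas Mbinℕ
  (λ n k j n<j → cong (_* ((k + j) C n)) (k>n⇒nCk≡0 n<j))
  (λ _ → Mbinℕ-split)
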